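{- Every 2-CNF theory (respectively, every normal 2-program, every disjunctive 2-program) with $n$ atoms has at most $3^{n/3} = 1.4422\ldots^n$ minimal models (respectively, stable models, answer sets).
   Context: A $t$-CNF theory is a finite set of propositional clauses, each containing at most $t$ literals; clauses contain no repeated literal and no pair of complementary literals. A normal program clause has the form $a \leftarrow b_1,\ldots,b_r,\mathbf{not}(c_1),\ldots,\mathbf{not}(c_s)$ and a disjunctive program clause the form $a_1\vee\cdots\vee a_p \leftarrow b_1,\ldots,b_r,\mathbf{not}(c_1),\ldots,\mathbf{not}(c_s)$; a (normal or disjunctive) $t$-program is a finite set of such clauses, each containing at most $t$ literals. Models, stable models (Gelfond–Lifschitz) and answer sets (minimal models of the Gelfond–Lifschitz reduct $P^M$) are represented as sets of true atoms; a model is minimal if no proper subset is a model. $n$ is the number of atoms occurring in the theory or program. -}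

module Defs where

open import Data.Nat using (ℕ; zero; suc; _+_; _≤_; _^_)
open import Data.Fin using (Fin)
open import Data.Fin.Subset using (Subset; _∈_; _∉_; _⊆_; _⊂_)
open import Data.List using (List; []; _∷_; length)
open import Data.List.Relation.Unary.All using (All)
open import Data.List.Relation.Unary.Any using (Any)
open import Data.List.Relation.Unary.Unique.Propositional using (Unique)
import Data.List.Membership.Propositional as LM
open import Data.Product using (_×_; ∃; Σ)
open import Relation.Nullary using (¬_)

data Literal (n : ℕ) : Set where
  pos : Fin n → Literal n
  neg : Fin n → Literal n

complement : ∀ {n} → Literal n → Literal n
complement (pos a) = neg a
complement (neg a) = pos a

Clause : ℕ → Set
Clause n = List (Literal n)

IsTClause : ∀ {n} → ℕ → Clause n → Set
IsTClause t C =
  length C ≤ t × Unique C × (∀ l → l LM.∈ C → ¬ (complement l LM.∈ C))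

Theory : ℕ → Set
Theory n = List (Clause n)

IsTCNF : ∀ {n} → ℕ → Theory n → Set
IsTCNF t T = All (IsTClause t) T

LitTrue : ∀ {n} → Subset n → Literal n → Set
LitTrue M (pos a) = a ∈ M
LitTrue M (neg a) = a ∉ M

SatClause : ∀ {n} → Subset n → Clause n → Set
SatClause M C = Any (LitTrue M) C

IsModel : ∀ {n} → Theory n → Subset n → Set
IsModel T M = All (SatClause M) T

IsMinimalModel : ∀ {n} → Theory n → Subset n → Set
IsMinimalModel T M = IsModel T M × (∀ N → N ⊂ M → ¬ IsModel T N)

OccursT : ∀ {n} → Theory n → Fin n → Set
OccursT T a = Any (λ C → pos a LM.∈ C ⊎' neg a LM.∈ C) T
  where
  open import Data.Sum using () renaming (_⊎_ to _⊎'_)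

record NClause (n : ℕ) : Set where
  constructor _⟵_∣_
  field
    head    : Fin n
    posBody : List (Fin n)
    negBody : List (Fin n)
open NClause public

NProgram : ℕ → Set
NProgram n = List (NClause n)

nsize : ∀ {n} → NClause n → ℕ
nsize r = suc (length (posBody r) + length (negBody r))

IsNormalTProgram : ∀ {n} → ℕ → NProgram n → Set
IsNormalTProgram t P = All (λ r → nsize r ≤ t) P

record HClause (n : ℕ) : Set where
  constructor _⟵h_
  field
    hhead : Fin n
    hbody : List (Fin n)
open HClause public

HSat : ∀ {n} → Subset n → HClause n → Set
HSat M r = All (_∈ M) (hbody r) → hhead r ∈ M

IsHModel : ∀ {n} → List (HClause n) → Subset n → Set
IsHModel P M = All (HSat M) P

open import Data.Fin.Subset using (Side; inside; outside)
open import Data.Vec using (lookup)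
open import Data.Bool using (Bool; true; false)

allOut : ∀ {n} → Subset n → List (Fin n) → Bool
allOut M [] = true
allOut M (c ∷ cs) with lookup M c
... | inside  = false
... | outside = allOut M cs

nreduct : ∀ {n} → NProgram n → Subset n → List (HClause n)
nreduct [] M = []
nreduct (r ∷ P) M with allOut M (negBody r)
... | true  = (head r ⟵h posBody r) ∷ nreduct P M
... | false = nreduct P M

IsLeastHModel : ∀ {n} → List (HClause n) → Subset n → Set
IsLeastHModel P M = IsHModel P M × (∀ N → IsHModel P N → M ⊆ N)

IsStableModel : ∀ {n} → NProgram n → Subset n → Set
IsStableModel P M = IsLeastHModel (nreduct P M) M

OccursN : ∀ {n} → NProgram n → Fin n → Set
OccursN P a = Any (λ r → (head r ≡' a) ⊎' (a LM.∈ posBody r ⊎' a LM.∈ negBody r)) P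
  where
  open import Data.Sum using () renaming (_⊎_ to _⊎'_)
  open import Relation.Binary.PropositionalEquality using () renaming (_≡_ to _≡'_)

record DClause (n : ℕ) : Set where
  constructor _⟵d_∣_
  field
    dhead    : List (Fin n)
    dposBody : List (Fin n)
    dnegBody : List (Fin n)
open DClause public

DProgram : ℕ → Set
DProgram n = List (DClause n)

dsize : ∀ {n} → DClause n → ℕ
dsize r = length (dhead r) + (length (dposBody r) + length (dnegBody r))

IsDisjTClause : ∀ {n} → ℕ → DClause n → Set
IsDisjTClause t r = 1 ≤ length (dhead r) × dsize r ≤ t

IsDisjunctiveTProgram : ∀ {n} → ℕ → DProgram n → Set
IsDisjunctiveTProgram t P = All (IsDisjTClause t) P

record PDClause (n : ℕ) : Set where
  constructor _⟵pd_
  field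
    pdhead : List (Fin n)
    pdbody : List (Fin n)
open PDClause public

PDSat : ∀ {n} → Subset n → PDClause n → Set
PDSat M r = All (_∈ M) (pdbody r) → Any (_∈ M) (pdhead r)

IsPDModel : ∀ {n} → List (PDClause n) → Subset n → Set
IsPDModel P M = All (PDSat M) P

dreduct : ∀ {n} → DProgram n → Subset n → List (PDClause n)
dreduct [] M = []
dreduct (r ∷ P) M with allOut M (dnegBody r)
... | true  = (dhead r ⟵pd dposBody r) ∷ dreduct P M
... | false = dreduct P M

IsAnswerSet : ∀ {n} → DProgram n → Subset n → Set
IsAnswerSet P M =
  IsPDModel (dreduct P M) M × (∀ N → N ⊂ M → ¬ IsPDModel (dreduct P M) N)

OccursD : ∀ {n} → DProgram n → Fin n → Set
OccursD P a = Any (λ r → a LM.∈ dhead r ⊎' (a LM.∈ dposBody r ⊎' a LM.∈ dnegBody r)) P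
  where
  open import Data.Sum using () renaming (_⊎_ to _⊎'_)

-- "X has at most 3^(n/3) elements with property Q":
-- every duplicate-free list of such elements has length k with k³ ≤ 3ⁿ
-- (k ≤ 3^(n/3) ⇔ k³ ≤ 3ⁿ for natural k).

AtMostCubeRoot3^ : ∀ {n} → ℕ → (Subset n → Set) → Set
AtMostCubeRoot3^ {n} m Q =
  ∀ (Ms : List (Subset n)) → Unique Ms → All Q Ms → length Ms ^ 3 ≤ 3 ^ m

-- Call atoms a and b in conflict when no model of the 2-CNF theory makes both false (a = b allowed).
-- Models of a 2-CNF theory are closed under the bitwise majority of three models, which yields a
-- Helly property: atoms that can be made false pairwise can be made false by a single model. Hence
-- the atoms a minimal model makes false form a maximal independent set of the conflict graph, and
-- the Moon–Moser bound 3^(n/3) on maximal independent sets applies. It is proved for families of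
-- maximal independent sets that agree outside a vertex list V. Take v ∈ V of minimum closed degree d.
-- If no set contains v, drop v from V. Otherwise every set contains some u ∈ N[v] ∩ V, and the sets
-- containing u agree outside V ∖ N[u], which has at most |V| − d vertices; so there are at most
-- d · 3^((|V| − d)/3) ≤ 3^(|V|/3) sets, as d³ ≤ 3^d.
-- Stable models are answer sets, and an answer set of P is a minimal model of P read as the
-- theory of clauses a₁ ∨ … ∨ aₚ ∨ ¬b₁ ∨ … ∨ ¬bᵣ ∨ c₁ ∨ … ∨ cₛ.
module Submission where

open import Data.Bool using (true; false)
open import Data.Vec using (lookup)
open import Data.Vec.Properties using ([]=⇒lookup; lookup⇒[]=)
open import Data.Fin using (Fin) renaming (_≟_ to _≟ᶠ_)
open import Data.Fin.Subset using (Subset; _∈_; _∉_; _⊆_; ∁; _∩_; _∪_)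
open import Data.Fin.Subset.Properties
  using (_∈?_; ⊆-antisym; anySubset?; x∈p∩q⁺; x∈p∩q⁻; x∈p∪q⁺; x∈p∪q⁻;
         x∈∁p⇒x∉p; x∉p⇒x∈∁p; x∉∁p⇒x∈p; x∈p⇒x∉∁p)
open import Data.List using (List; []; _∷_; _++_; length; map; filter; allFin)
open import Data.List.Extrema.Nat
  using (argmin; argmin-sel; f[argmin]≤f[⊤]; f[argmin]≤f[xs]; max; xs≤max; argmax-all)
open import Data.List.Membership.Propositional renaming (_∈_ to _∈ˡ_; _∉_ to _∉ˡ_)
open import Data.List.Membership.Propositional.Properties using (∈-filter⁺; ∈-filter⁻; ∈-allFin)
open import Data.List.Properties using (length-map; length-++; length-tabulate; filter-notAll)
open import Data.List.Relation.Unary.All as All using (All; []; _∷_)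
import Data.List.Relation.Unary.All.Properties as All
open import Data.List.Relation.Unary.Any as Any using (Any; here; there)
import Data.List.Relation.Unary.Any.Properties as Any
open import Data.List.Relation.Unary.AllPairs using (_∷_)
open import Data.List.Relation.Unary.Unique.Propositional using (Unique)
import Data.List.Relation.Unary.Unique.Propositional.Properties as Unique
open import Data.Nat using (ℕ; suc; _+_; _*_; _^_; _≤_; _<_; z≤n; s≤s)
open import Data.Nat.Induction using (<-wellFounded)
open import Data.Nat.ListAction using (sum)
open import Data.Nat.Properties
open import Data.Nat.Tactic.RingSolver using (solve-∀)
open import Data.Product using (_×_; _,_; proj₁; proj₂; ∃-syntax)
open import Data.Sum as Sum using (_⊎_; inj₁; inj₂; [_,_]′)
open import Function using (_∘_)
open import Induction.WellFounded using (Acc; acc)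
open import Relation.Binary.PropositionalEquality
open import Relation.Nullary using (¬_; Dec; yes; no; ¬?; contradiction)
open import Relation.Nullary.Decidable using (decidable-stable; _×-dec_; _⊎-dec_)
open import Relation.Unary using (Decidable)

open import Defs

-- The ring solver does not read _^_, so these identities are proved for x * (x * (x * 1)),
-- which is x ^ 3 by definition.
3*cube≡cube+ : ∀ j → 3 * (3 + j) ^ 3 ≡ (4 + j) ^ 3 + (17 + 33 * j + 15 * (j * j) + 2 * (j * (j * j)))
3*cube≡cube+ = expanded
  where
  expanded : ∀ j → 3 * ((3 + j) * ((3 + j) * ((3 + j) * 1)))
                 ≡ (4 + j) * ((4 + j) * ((4 + j) * 1)) + (17 + 33 * j + 15 * (j * j) + 2 * (j * (j * j)))
  expanded = solve-∀

cube-* : ∀ k c → (k * c) ^ 3 ≡ k ^ 3 * c ^ 3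
cube-* = expanded
  where
  expanded : ∀ k c → (k * c) * ((k * c) * ((k * c) * 1)) ≡ (k * (k * (k * 1))) * (c * (c * (c * 1)))
  expanded = solve-∀

cube≤3^ : ∀ k → k ^ 3 ≤ 3 ^ k
cube≤3^ 0 = z≤n
cube≤3^ 1 = s≤s z≤n
cube≤3^ 2 = n≤1+n 8
cube≤3^ 3 = ≤-refl
cube≤3^ (suc (suc (suc (suc j)))) = begin
  (4 + j) ^ 3      ≤⟨ m≤m+n _ _ ⟩
  (4 + j) ^ 3 + _  ≡⟨ 3*cube≡cube+ j ⟨
  3 * (3 + j) ^ 3  ≤⟨ *-monoʳ-≤ 3 (cube≤3^ (suc (suc (suc j)))) ⟩
  3 * 3 ^ (3 + j)  ∎
  where open ≤-Reasoning

sum≤length*bound : ∀ {c} (ℓs : List ℕ) → All (_≤ c) ℓs → sum ℓs ≤ length ℓs * c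
sum≤length*bound []       []         = z≤n
sum≤length*bound (ℓ ∷ ℓs) (ℓ≤c ∷ ℓs≤c) = +-mono-≤ ℓ≤c (sum≤length*bound ℓs ℓs≤c)

cube-sum≤ : ∀ m {B : Set} (f : B → ℕ) (bs : List B) → All (λ b → f b ^ 3 * 3 ^ length bs ≤ 3 ^ m) bs →
            sum (map f bs) ^ 3 ≤ 3 ^ m
cube-sum≤ m f bs bounded = begin
  sum (map f bs) ^ 3           ≤⟨ ^-monoˡ-≤ 3 (sum≤length*bound (map f bs) (xs≤max 0 (map f bs))) ⟩
  (length (map f bs) * c) ^ 3  ≡⟨ cong (λ k → (k * c) ^ 3) (length-map f bs) ⟩
  (k * c) ^ 3                  ≡⟨ cube-* k c ⟩
  k ^ 3 * c ^ 3                ≤⟨ *-monoˡ-≤ (c ^ 3) (cube≤3^ k) ⟩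
  3 ^ k * c ^ 3                ≡⟨ *-comm (3 ^ k) (c ^ 3) ⟩
  c ^ 3 * 3 ^ k                ≤⟨ argmax-all (λ x → x) {P = λ ℓ → ℓ ^ 3 * 3 ^ k ≤ 3 ^ m} z≤n (All.map⁺ bounded) ⟩
  3 ^ m                        ∎
  where
  open ≤-Reasoning
  k = length bs
  c = max 0 (map f bs)

sum-map-mono-≤ : ∀ {B : Set} {f g : B → ℕ} (bs : List B) → (∀ b → f b ≤ g b) →
                 sum (map f bs) ≤ sum (map g bs)
sum-map-mono-≤ []       f≤g = z≤n
sum-map-mono-≤ (b ∷ bs) f≤g = +-mono-≤ (f≤g b) (sum-map-mono-≤ bs f≤g)

sum-map-mono-< : ∀ {B : Set} {f g : B → ℕ} (bs : List B) → (∀ b → f b ≤ g b) →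
                 Any (λ b → f b < g b) bs → sum (map f bs) < sum (map g bs)
sum-map-mono-< (b ∷ bs) f≤g (here fb<gb) = +-mono-<-≤ fb<gb (sum-map-mono-≤ bs f≤g)
sum-map-mono-< (b ∷ bs) f≤g (there any)  = +-mono-≤-< (f≤g b) (sum-map-mono-< bs f≤g any)

module _ {A : Set} {P : A → Set} (P? : Decidable P) where

  length-filter+length-filter-¬ : ∀ xs → length (filter P? xs) + length (filter (¬? ∘ P?) xs) ≡ length xs
  length-filter+length-filter-¬ []       = refl
  length-filter+length-filter-¬ (x ∷ xs) with P? x
  ... | yes _ = cong suc (length-filter+length-filter-¬ xs)
  ... | no  _ = trans (+-suc _ _) (cong suc (length-filter+length-filter-¬ xs))

  length-filter-∷-≤ : ∀ x xs → length (filter P? xs) ≤ length (filter P? (x ∷ xs))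
  length-filter-∷-≤ x xs with P? x
  ... | yes _ = n≤1+n _
  ... | no  _ = ≤-refl

  length-filter-∷-< : ∀ {x} xs → P x → length (filter P? xs) < length (filter P? (x ∷ xs))
  length-filter-∷-< {x} xs px with P? x
  ... | yes _  = ≤-refl
  ... | no ¬px = contradiction px ¬px

  ∉-filter-¬⇒ : ∀ {x xs} → x ∈ˡ xs → x ∉ˡ filter (¬? ∘ P?) xs → P x
  ∉-filter-¬⇒ {x} x∈xs x∉ = decidable-stable (P? x) (x∉ ∘ ∈-filter⁺ (¬? ∘ P?) x∈xs)

  length-filter-¬-< : ∀ {x} xs → x ∈ˡ xs → P x → length (filter (¬? ∘ P?) xs) < length xs
  length-filter-¬-< xs x∈xs px = filter-notAll (¬? ∘ P?) xs (Any.map (λ { refl ¬px → ¬px px }) x∈xs)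

module _ {A B : Set} {R : B → A → Set} (R? : ∀ b → Decidable (R b)) where

  length≤sum-length-filter : ∀ (bs : List B) (xs : List A) → All (λ x → Any (λ b → R b x) bs) xs →
                             length xs ≤ sum (map (λ b → length (filter (R? b) xs)) bs)
  length≤sum-length-filter bs []       []           = z≤n
  length≤sum-length-filter bs (x ∷ xs) (hit ∷ hits) = begin-strict
    length xs                                             ≤⟨ length≤sum-length-filter bs xs hits ⟩
    sum (map (λ b → length (filter (R? b) xs)) bs)        <⟨ sum-map-mono-< bs
                                                               (λ b → length-filter-∷-≤ (R? b) x xs)
                                                               (Any.map (λ {b} → length-filter-∷-< (R? b) xs) hit) ⟩
    sum (map (λ b → length (filter (R? b) (x ∷ xs))) bs)  ∎
    where open ≤-Reasoning

module MoonMoser {n : ℕ} (E : Fin n → Fin n → Set) (E? : ∀ a b → Dec (E a b)) where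

  open import Data.List.Membership.DecPropositional (_≟ᶠ_ {n}) using () renaming (_∈?_ to _∈ˡ?_)

  IsIndependent : Subset n → Set
  IsIndependent S = ∀ {a b} → a ∈ S → b ∈ S → ¬ E a b

  IsDominating : Subset n → Set
  IsDominating S = ∀ {v} → v ∉ S → E v v ⊎ ∃[ u ] u ∈ S × E v u

  IsMaximalIndependent : Subset n → Set
  IsMaximalIndependent S = IsIndependent S × IsDominating S

  AgreeOutside : List (Fin n) → List (Subset n) → Set
  AgreeOutside V Ss = ∀ {S S′ x} → S ∈ˡ Ss → S′ ∈ˡ Ss → x ∉ˡ V → x ∈ S → x ∈ S′

  InClosedNeighbourhood : Fin n → Fin n → Set
  InClosedNeighbourhood u x = x ≡ u ⊎ E u x

  inClosedNeighbourhood? : ∀ u → Decidable (InClosedNeighbourhood u)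
  inClosedNeighbourhood? u x = (x ≟ᶠ u) ⊎-dec E? u x

  closedNeighbourhood : List (Fin n) → Fin n → List (Fin n)
  closedNeighbourhood V u = filter (inClosedNeighbourhood? u) V

  outsideClosedNeighbourhood : List (Fin n) → Fin n → List (Fin n)
  outsideClosedNeighbourhood V u = filter (¬? ∘ inClosedNeighbourhood? u) V

  degree : List (Fin n) → Fin n → ℕ
  degree V u = length (closedNeighbourhood V u)

  containing : Fin n → List (Subset n) → List (Subset n)
  containing u Ss = filter (u ∈?_) Ss

  MisBound : List (Fin n) → Set
  MisBound V = ∀ Ss → Unique Ss → All IsMaximalIndependent Ss → AgreeOutside V Ss →
               length Ss ^ 3 ≤ 3 ^ length V

  SmallerMisBound : List (Fin n) → Set
  SmallerMisBound V = ∀ {W} → length W < length V → MisBound W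

  misBound-[] : MisBound []
  misBound-[] []            _                _ _     = z≤n
  misBound-[] (S ∷ [])      _                _ _     = s≤s z≤n
  misBound-[] (S ∷ S′ ∷ Ss) ((S≢S′ ∷ _) ∷ _) _ agree =
    contradiction (⊆-antisym (agree (here refl) (there (here refl)) (λ ()))
                             (agree (there (here refl)) (here refl) (λ ())))
                  S≢S′

  agreeOutside-without : ∀ {V v Ss} → AgreeOutside V Ss → All (v ∉_) Ss →
                         AgreeOutside (filter (¬? ∘ (_≟ᶠ v)) V) Ss
  agreeOutside-without {V} agree v∉Ss {x = x} S∈Ss S′∈Ss x∉W x∈S with x ∈ˡ? V
  ... | no  x∉V = agree S∈Ss S′∈Ss x∉V x∈S
  ... | yes x∈V with refl ← ∉-filter-¬⇒ (_≟ᶠ _) x∈V x∉W = contradiction x∈S (All.lookup v∉Ss S∈Ss)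

  misBound-without : ∀ {V v} → v ∈ˡ V → SmallerMisBound V →
                     ∀ Ss → Unique Ss → All IsMaximalIndependent Ss → AgreeOutside V Ss → All (v ∉_) Ss →
                     length Ss ^ 3 ≤ 3 ^ length V
  misBound-without {V} {v} v∈V ih Ss unique mis agree v∉Ss =
    ≤-trans (ih shorter Ss unique mis (agreeOutside-without agree v∉Ss)) (^-monoʳ-≤ 3 (<⇒≤ shorter))
    where
    shorter = length-filter-¬-< (_≟ᶠ v) V v∈V refl

  agreeOutside-containing : ∀ {V u Ss} → All IsMaximalIndependent Ss → AgreeOutside V Ss →
                            AgreeOutside (outsideClosedNeighbourhood V u) (containing u Ss)
  agreeOutside-containing {V} {u} mis agree {x = x} S∈ S′∈ x∉W x∈S
    with ∈-filter⁻ (u ∈?_) S∈ | ∈-filter⁻ (u ∈?_) S′∈ | x ∈ˡ? V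
  ... | S∈Ss , u∈S | S′∈Ss , u∈S′ | no x∉V = agree S∈Ss S′∈Ss x∉V x∈S
  ... | S∈Ss , u∈S | S′∈Ss , u∈S′ | yes x∈V with ∉-filter-¬⇒ (inClosedNeighbourhood? u) x∈V x∉W
  ...   | inj₁ refl = u∈S′
  ...   | inj₂ Eux  = contradiction Eux (proj₁ (All.lookup mis S∈Ss) u∈S x∈S)

  -- A set missing N[v] ∩ V has, by maximality, a neighbour of v outside V, and agreement outside V
  -- puts that neighbour into the set containing v as well.
  meets-closedNeighbourhood : ∀ {V v Ss} → v ∈ˡ V → All IsMaximalIndependent Ss → AgreeOutside V Ss →
                              Any (v ∈_) Ss → All (λ S → Any (_∈ S) (closedNeighbourhood V v)) Ss
  meets-closedNeighbourhood {V} {v} {Ss} v∈V mis agree v∈Ss = All.tabulate meets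
    where
    witness = find v∈Ss
    S₀∈Ss = proj₁ (proj₂ witness)
    v∈S₀  = proj₂ (proj₂ witness)
    independent₀ = proj₁ (All.lookup mis S₀∈Ss)

    meets : ∀ {S} → S ∈ˡ Ss → Any (_∈ S) (closedNeighbourhood V v)
    meets {S} S∈Ss with v ∈? S
    ... | yes v∈S = lose (∈-filter⁺ (inClosedNeighbourhood? v) v∈V (inj₁ refl)) v∈S
    ... | no  v∉S with proj₂ (All.lookup mis S∈Ss) v∉S
    ...   | inj₁ Evv = contradiction Evv (independent₀ v∈S₀ v∈S₀)
    ...   | inj₂ (u , u∈S , Evu) with u ∈ˡ? V
    ...     | yes u∈V = lose (∈-filter⁺ (inClosedNeighbourhood? v) u∈V (inj₂ Evu)) u∈S
    ...     | no  u∉V = contradiction Evu (independent₀ v∈S₀ (agree S∈Ss S₀∈Ss u∉V u∈S))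

  misBound-containing : ∀ {V u} → u ∈ˡ V → SmallerMisBound V →
                        ∀ Ss → Unique Ss → All IsMaximalIndependent Ss → AgreeOutside V Ss →
                        length (containing u Ss) ^ 3 * 3 ^ degree V u ≤ 3 ^ length V
  misBound-containing {V} {u} u∈V ih Ss unique mis agree = begin
    length (containing u Ss) ^ 3 * 3 ^ degree V u  ≤⟨ *-monoˡ-≤ (3 ^ degree V u) bound ⟩
    3 ^ length R * 3 ^ degree V u                  ≡⟨ ^-distribˡ-+-* 3 (length R) (degree V u) ⟨
    3 ^ (length R + degree V u)                    ≡⟨ cong (3 ^_) (+-comm (length R) (degree V u)) ⟩
    3 ^ (degree V u + length R)                    ≡⟨ cong (3 ^_) (length-filter+length-filter-¬ _ V) ⟩
    3 ^ length V                                   ∎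
    where
    open ≤-Reasoning
    R = outsideClosedNeighbourhood V u
    bound = ih (length-filter-¬-< (inClosedNeighbourhood? u) V u∈V (inj₁ refl)) (containing u Ss)
               (Unique.filter⁺ (u ∈?_) unique) (All.filter⁺ (u ∈?_) mis) (agreeOutside-containing mis agree)

  misBound-branch : ∀ {V v} → v ∈ˡ V → All (λ u → degree V v ≤ degree V u) V → SmallerMisBound V →
                    ∀ Ss → Unique Ss → All IsMaximalIndependent Ss → AgreeOutside V Ss → Any (v ∈_) Ss →
                    length Ss ^ 3 ≤ 3 ^ length V
  misBound-branch {V} {v} v∈V minimum ih Ss unique mis agree v∈Ss = begin
    length Ss ^ 3                                      ≤⟨ ^-monoˡ-≤ 3 covered ⟩
    sum (map (λ u → length (containing u Ss)) Bs) ^ 3  ≤⟨ cube-sum≤ (length V) _ Bs (All.tabulate branch) ⟩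
    3 ^ length V                                       ∎
    where
    open ≤-Reasoning
    Bs = closedNeighbourhood V v
    covered = length≤sum-length-filter _∈?_ Bs Ss (meets-closedNeighbourhood v∈V mis agree v∈Ss)

    branch : ∀ {u} → u ∈ˡ Bs → length (containing u Ss) ^ 3 * 3 ^ length Bs ≤ 3 ^ length V
    branch {u} u∈Bs =
      ≤-trans (*-monoʳ-≤ (length (containing u Ss) ^ 3) (^-monoʳ-≤ 3 (All.lookup minimum u∈V)))
              (misBound-containing u∈V ih Ss unique mis agree)
      where u∈V = proj₁ (∈-filter⁻ (inClosedNeighbourhood? v) u∈Bs)

  minimumDegree : ∀ x xs → ∃[ v ] v ∈ˡ x ∷ xs × All (λ u → degree (x ∷ xs) v ≤ degree (x ∷ xs) u) (x ∷ xs)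
  minimumDegree x xs = v , v∈ , f[argmin]≤f[⊤] {f = d} x xs ∷ f[argmin]≤f[xs] {f = d} x xs
    where
    d = degree (x ∷ xs)
    v = argmin d x xs
    v∈ : v ∈ˡ x ∷ xs
    v∈ = [ here , there ]′ (argmin-sel d x xs)

  misBound-step : ∀ V → SmallerMisBound V → MisBound V
  misBound-step []       _  = misBound-[]
  misBound-step (x ∷ xs) ih Ss unique mis agree with minimumDegree x xs
  ... | v , v∈V , minimum with Any.any? (v ∈?_) Ss
  ...   | yes v∈Ss = misBound-branch v∈V minimum ih Ss unique mis agree v∈Ss
  ...   | no  v∉Ss = misBound-without v∈V ih Ss unique mis agree (All.¬Any⇒All¬ Ss v∉Ss)

  misBound : ∀ V → MisBound V
  misBound V = go V (<-wellFounded (length V))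
    where
    go : ∀ V → Acc _<_ (length V) → MisBound V
    go V (acc smaller) = misBound-step V (λ shorter → go _ (smaller shorter))

  moonMoser : ∀ Ss → Unique Ss → All IsMaximalIndependent Ss → length Ss ^ 3 ≤ 3 ^ n
  moonMoser Ss unique mis =
    subst (λ m → length Ss ^ 3 ≤ 3 ^ m) (length-tabulate {n = n} (λ i → i))
          (misBound (allFin n) Ss unique mis (λ _ _ x∉ _ → contradiction (∈-allFin _) x∉))

Majority : Set → Set → Set → Set
Majority P Q R = (P × Q) ⊎ (P × R) ⊎ (Q × R)

majority-clash : ∀ {P Q R} → Majority P Q R → ¬ Majority (¬ P) (¬ Q) (¬ R)
majority-clash (inj₁ (p , q))        (inj₁ (¬p , _))        = ¬p p
majority-clash (inj₁ (p , q))        (inj₂ (inj₁ (¬p , _))) = ¬p p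
majority-clash (inj₁ (p , q))        (inj₂ (inj₂ (¬q , _))) = ¬q q
majority-clash (inj₂ (inj₁ (p , r))) (inj₁ (¬p , _))        = ¬p p
majority-clash (inj₂ (inj₁ (p , r))) (inj₂ (inj₁ (¬p , _))) = ¬p p
majority-clash (inj₂ (inj₁ (p , r))) (inj₂ (inj₂ (_ , ¬r))) = ¬r r
majority-clash (inj₂ (inj₂ (q , r))) (inj₁ (_ , ¬q))        = ¬q q
majority-clash (inj₂ (inj₂ (q , r))) (inj₂ (inj₁ (_ , ¬r))) = ¬r r
majority-clash (inj₂ (inj₂ (q , r))) (inj₂ (inj₂ (¬q , _))) = ¬q q

module _ {n : ℕ} where

  ∁-injective : ∀ {p q : Subset n} → ∁ p ≡ ∁ q → p ≡ q
  ∁-injective {p} {q} ∁p≡∁q =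
    ⊆-antisym (λ x∈p → x∉∁p⇒x∈p (subst (_ ∉_) ∁p≡∁q (x∈p⇒x∉∁p x∈p)))
              (λ x∈q → x∉∁p⇒x∈p (subst (_ ∉_) (sym ∁p≡∁q) (x∈p⇒x∉∁p x∈q)))

  median : Subset n → Subset n → Subset n → Subset n
  median A B C = (A ∩ B) ∪ ((A ∩ C) ∪ (B ∩ C))

  module _ {A B C : Subset n} where

    ∈-median⁺ : ∀ {x} → Majority (x ∈ A) (x ∈ B) (x ∈ C) → x ∈ median A B C
    ∈-median⁺ = x∈p∪q⁺ ∘ Sum.map x∈p∩q⁺ (x∈p∪q⁺ ∘ Sum.map x∈p∩q⁺ x∈p∩q⁺)

    ∈-median⁻ : ∀ {x} → x ∈ median A B C → Majority (x ∈ A) (x ∈ B) (x ∈ C)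
    ∈-median⁻ = Sum.map (x∈p∩q⁻ A B) (Sum.map (x∈p∩q⁻ A C) (x∈p∩q⁻ B C) ∘ x∈p∪q⁻ _ _) ∘ x∈p∪q⁻ _ _

    litTrue-median : ∀ l → Majority (LitTrue A l) (LitTrue B l) (LitTrue C l) → LitTrue (median A B C) l
    litTrue-median (pos a) = ∈-median⁺
    litTrue-median (neg a) majority a∈median = majority-clash (∈-median⁻ a∈median) majority

    -- Three witnesses in a clause of at most two literals: two of them pick the same literal.
    satClause-median : ∀ K → length K ≤ 2 → SatClause A K → SatClause B K → SatClause C K →
                       SatClause (median A B C) K
    satClause-median (l ∷ [])      _ (here a) (here b) _ = here (litTrue-median l (inj₁ (a , b)))
    satClause-median (l ∷ l′ ∷ []) _ (here a) (here b) _ = here (litTrue-median l (inj₁ (a , b)))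
    satClause-median (l ∷ l′ ∷ []) _ (here a) (there (here b)) (here c) =
      here (litTrue-median l (inj₂ (inj₁ (a , c))))
    satClause-median (l ∷ l′ ∷ []) _ (here a) (there (here b)) (there (here c)) =
      there (here (litTrue-median l′ (inj₂ (inj₂ (b , c)))))
    satClause-median (l ∷ l′ ∷ []) _ (there (here a)) (here b) (here c) =
      here (litTrue-median l (inj₂ (inj₂ (b , c))))
    satClause-median (l ∷ l′ ∷ []) _ (there (here a)) (here b) (there (here c)) =
      there (here (litTrue-median l′ (inj₂ (inj₁ (a , c)))))
    satClause-median (l ∷ l′ ∷ []) _ (there (here a)) (there (here b)) _ =
      there (here (litTrue-median l′ (inj₁ (a , b))))
    satClause-median (_ ∷ _ ∷ _ ∷ _) (s≤s (s≤s ())) _ _ _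

    isModel-median : ∀ {T} → All (λ K → length K ≤ 2) T → IsModel T A → IsModel T B → IsModel T C →
                     IsModel T (median A B C)
    isModel-median short modelA modelB modelC = All.tabulate λ K∈T →
      satClause-median _ (All.lookup short K∈T)
                         (All.lookup modelA K∈T) (All.lookup modelB K∈T) (All.lookup modelC K∈T)

module TwoCNF {n : ℕ} (T : Theory n) (short : All (λ K → length K ≤ 2) T) where

  isModel? : ∀ N → Dec (IsModel T N)
  isModel? N = All.all? (Any.any? litTrue?) T
    where
    litTrue? : ∀ l → Dec (LitTrue N l)
    litTrue? (pos a) = a ∈? N
    litTrue? (neg a) = ¬? (a ∈? N)

  Avoidable : List (Fin n) → Set
  Avoidable L = ∃[ N ] IsModel T N × All (_∉ N) L

  avoidable? : ∀ L → Dec (Avoidable L)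
  avoidable? L = anySubset? λ N → isModel? N ×-dec All.all? (λ x → ¬? (x ∈? N)) L

  avoidable-swap : ∀ {a b} → Avoidable (a ∷ b ∷ []) → Avoidable (b ∷ a ∷ [])
  avoidable-swap (N , model , a∉N ∷ b∉N ∷ []) = N , model , b∉N ∷ a∉N ∷ []

  PairwiseAvoidable : List (Fin n) → Set
  PairwiseAvoidable L = ∀ {a b} → a ∈ˡ L → b ∈ˡ L → Avoidable (a ∷ b ∷ [])

  -- Each of a, b, c is avoided by two of the three models given by induction, hence by their median.
  pairwiseAvoidable⇒avoidable-∷∷ : ∀ a b R → PairwiseAvoidable (a ∷ b ∷ R) → Avoidable (a ∷ b ∷ R)
  pairwiseAvoidable⇒avoidable-∷∷ a b []      pairwise = pairwise (here refl) (there (here refl))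
  pairwiseAvoidable⇒avoidable-∷∷ a b (c ∷ R) pairwise
    with pairwiseAvoidable⇒avoidable-∷∷ b c R (λ x∈ y∈ → pairwise (there x∈) (there y∈))
       | pairwiseAvoidable⇒avoidable-∷∷ a c R (λ x∈ y∈ → pairwise (skip-b x∈) (skip-b y∈))
       | pairwiseAvoidable⇒avoidable-∷∷ a b R (λ x∈ y∈ → pairwise (skip-c x∈) (skip-c y∈))
    where
    skip-b : ∀ {x} → x ∈ˡ a ∷ c ∷ R → x ∈ˡ a ∷ b ∷ c ∷ R
    skip-b (here x≡a) = here x≡a
    skip-b (there x∈) = there (there x∈)
    skip-c : ∀ {x} → x ∈ˡ a ∷ b ∷ R → x ∈ˡ a ∷ b ∷ c ∷ R
    skip-c (here x≡a)         = here x≡a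
    skip-c (there (here x≡b)) = there (here x≡b)
    skip-c (there (there x∈)) = there (there (there x∈))
  ... | N₁ , model₁ , b∉N₁ ∷ c∉N₁ ∷ R∉N₁
      | N₂ , model₂ , a∉N₂ ∷ c∉N₂ ∷ R∉N₂
      | N₃ , model₃ , a∉N₃ ∷ b∉N₃ ∷ _ =
    median N₁ N₂ N₃ , isModel-median short model₁ model₂ model₃ ,
    litTrue-median (neg a) (inj₂ (inj₂ (a∉N₂ , a∉N₃))) ∷
    litTrue-median (neg b) (inj₂ (inj₁ (b∉N₁ , b∉N₃))) ∷
    litTrue-median (neg c) (inj₁ (c∉N₁ , c∉N₂)) ∷
    All.zipWith (litTrue-median (neg _) ∘ inj₁) (R∉N₁ , R∉N₂)

  pairwiseAvoidable⇒avoidable : ∀ a L → PairwiseAvoidable (a ∷ L) → Avoidable (a ∷ L)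
  pairwiseAvoidable⇒avoidable a []      pairwise with pairwise (here refl) (here refl)
  ... | N , model , a∉N ∷ _ = N , model , a∉N ∷ []
  pairwiseAvoidable⇒avoidable a (b ∷ R) pairwise = pairwiseAvoidable⇒avoidable-∷∷ a b R pairwise

  Conflict : Fin n → Fin n → Set
  Conflict a b = ¬ Avoidable (a ∷ b ∷ [])

  conflict? : ∀ a b → Dec (Conflict a b)
  conflict? a b = ¬? (avoidable? (a ∷ b ∷ []))

  ¬conflict⇒avoidable : ∀ {a b} → ¬ Conflict a b → Avoidable (a ∷ b ∷ [])
  ¬conflict⇒avoidable = decidable-stable (avoidable? _)

  open MoonMoser Conflict conflict?

  -- Without such conflicts v and the atoms outside M would be pairwise avoidable, and a model
  -- avoiding all of them would lie strictly below M.
  minimal⇒conflict : ∀ {M v} → IsMinimalModel T M → v ∈ M → ¬ Conflict v v →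
                     ¬ (∀ {u} → u ∉ M → ¬ Conflict v u)
  minimal⇒conflict {M} {v} (modelM , minimal) v∈M ¬Cvv ¬Cv-outside
    with pairwiseAvoidable⇒avoidable v outside pairwise
    where
    outside = filter (λ u → ¬? (u ∈? M)) (allFin n)
    ∈outside⇒∉ : ∀ {u} → u ∈ˡ outside → u ∉ M
    ∈outside⇒∉ = proj₂ ∘ ∈-filter⁻ (λ u → ¬? (u ∈? M)) {xs = allFin n}
    pairwise : PairwiseAvoidable (v ∷ outside)
    pairwise (here refl) (here refl) = ¬conflict⇒avoidable ¬Cvv
    pairwise (here refl) (there b∈)  = ¬conflict⇒avoidable (¬Cv-outside (∈outside⇒∉ b∈))
    pairwise (there a∈)  (here refl) = avoidable-swap (¬conflict⇒avoidable (¬Cv-outside (∈outside⇒∉ a∈)))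
    pairwise (there a∈)  (there b∈)  = M , modelM , ∈outside⇒∉ a∈ ∷ ∈outside⇒∉ b∈ ∷ []
  ... | N , modelN , v∉N ∷ outside∉N = minimal N (N⊆M , v , v∈M , v∉N) modelN
    where
    N⊆M : N ⊆ M
    N⊆M {x} x∈N with x ∈? M
    ... | yes x∈M = x∈M
    ... | no  x∉M =
      contradiction x∈N (All.lookup outside∉N (∈-filter⁺ (λ u → ¬? (u ∈? M)) (∈-allFin x) x∉M))

  ∁-isMaximalIndependent : ∀ {M} → IsMinimalModel T M → IsMaximalIndependent (∁ M)
  ∁-isMaximalIndependent {M} minimalM@(modelM , _) = independent , dominating
    where
    independent : IsIndependent (∁ M)
    independent a∈ b∈ conflict = conflict (M , modelM , x∈∁p⇒x∉p a∈ ∷ x∈∁p⇒x∉p b∈ ∷ [])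

    dominating : IsDominating (∁ M)
    dominating {v} v∉∁M with conflict? v v
    ... | yes Cvv = inj₁ Cvv
    ... | no ¬Cvv with Any.any? (λ u → (u ∈? ∁ M) ×-dec conflict? v u) (allFin n)
    ...   | yes some = let (u , _ , u∈∁M , Cvu) = find some in inj₂ (u , u∈∁M , Cvu)
    ...   | no  none = contradiction (λ {u} u∉M Cvu → none (lose (∈-allFin u) (x∉p⇒x∈∁p u∉M , Cvu)))
                                     (minimal⇒conflict minimalM (x∉∁p⇒x∈p v∉∁M) ¬Cvv)

  minimalModels-bound : AtMostCubeRoot3^ n (IsMinimalModel T)
  minimalModels-bound Ms unique minimal =
    subst (λ k → k ^ 3 ≤ 3 ^ n) (length-map ∁ Ms)
          (moonMoser (map ∁ Ms) (Unique.map⁺ ∁-injective unique)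
                     (All.map⁺ (All.map ∁-isMaximalIndependent minimal)))

module Programs {n : ℕ} where

  allOut≡true⇒ : ∀ {M : Subset n} cs → allOut M cs ≡ true → All (_∉ M) cs
  allOut≡true⇒     []       _  = []
  allOut≡true⇒ {M} (c ∷ cs) eq with lookup M c in c∈?M
  ... | false = (λ c∈M → contradiction (trans (sym c∈?M) ([]=⇒lookup c∈M)) λ ()) ∷ allOut≡true⇒ cs eq

  allOut≡false⇒ : ∀ {M : Subset n} cs → allOut M cs ≡ false → Any (_∈ M) cs
  allOut≡false⇒ {M} (c ∷ cs) eq with lookup M c in c∈?M
  ... | true  = here (lookup⇒[]= c M c∈?M)
  ... | false = there (allOut≡false⇒ cs eq)

  clause : DClause n → Clause n
  clause r = map pos (dhead r) ++ map neg (dposBody r) ++ map pos (dnegBody r)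

  length-clause : ∀ r → length (clause r) ≡ dsize r
  length-clause (h ⟵d b ∣ c) =
    trans (length-++ (map pos h))
          (cong₂ _+_ (length-map pos h)
                     (trans (length-++ (map neg b)) (cong₂ _+_ (length-map neg b) (length-map pos c))))

  module _ {N : Subset n} (r : DClause n) where

    satClause⁺ : Any (_∈ N) (dhead r) ⊎ Any (_∉ N) (dposBody r) ⊎ Any (_∈ N) (dnegBody r) →
                 SatClause N (clause r)
    satClause⁺ = [ Any.++⁺ˡ ∘ Any.map⁺ {f = pos}
                 , Any.++⁺ʳ (map pos (dhead r)) ∘ [ Any.++⁺ˡ ∘ Any.map⁺ {f = neg}
                                                  , Any.++⁺ʳ (map neg (dposBody r)) ∘ Any.map⁺ {f = pos} ]′ ]′

    satClause⁻ : SatClause N (clause r) →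
                 Any (_∈ N) (dhead r) ⊎ Any (_∉ N) (dposBody r) ⊎ Any (_∈ N) (dnegBody r)
    satClause⁻ = Sum.map (Any.map⁻ {f = pos})
                         (Sum.map (Any.map⁻ {f = neg}) (Any.map⁻ {f = pos}) ∘ Any.++⁻ (map neg (dposBody r)))
               ∘ Any.++⁻ (map pos (dhead r))

  module _ {M : Subset n} (r : DClause n) (kept : allOut M (dnegBody r) ≡ true) where

    pdSat⇒satClause : PDSat M (dhead r ⟵pd dposBody r) → SatClause M (clause r)
    pdSat⇒satClause sat with All.all? (_∈? M) (dposBody r)
    ... | yes body = satClause⁺ r (inj₁ (sat body))
    ... | no ¬body = satClause⁺ r (inj₂ (inj₁ (All.¬All⇒Any¬ (_∈? M) _ ¬body)))

    satClause⇒pdSat : ∀ {N} → N ⊆ M → SatClause N (clause r) → PDSat N (dhead r ⟵pd dposBody r)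
    satClause⇒pdSat N⊆M sat body with satClause⁻ r sat
    ... | inj₁ head∈N           = head∈N
    ... | inj₂ (inj₁ body∉N)    = contradiction body (All.Any¬⇒¬All body∉N)
    ... | inj₂ (inj₂ negBody∈N) =
      contradiction (Any.map N⊆M negBody∈N) (All.All¬⇒¬Any (allOut≡true⇒ _ kept))

  isPDModel⇒isModel : ∀ P {M} → IsPDModel (dreduct P M) M → IsModel (map clause P) M
  isPDModel⇒isModel []      []    = []
  isPDModel⇒isModel (r ∷ P) {M} model with allOut M (dnegBody r) in eq
  isPDModel⇒isModel (r ∷ P) (sat ∷ model) | true  = pdSat⇒satClause r eq sat ∷ isPDModel⇒isModel P model
  isPDModel⇒isModel (r ∷ P) model         | false =
    satClause⁺ r (inj₂ (inj₂ (allOut≡false⇒ _ eq))) ∷ isPDModel⇒isModel P model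

  isModel⇒isPDModel : ∀ P {M N} → N ⊆ M → IsModel (map clause P) N → IsPDModel (dreduct P M) N
  isModel⇒isPDModel []      _   []    = []
  isModel⇒isPDModel (r ∷ P) {M} N⊆M (sat ∷ model) with allOut M (dnegBody r) in eq
  ... | true  = satClause⇒pdSat r eq N⊆M sat ∷ isModel⇒isPDModel P N⊆M model
  ... | false = isModel⇒isPDModel P N⊆M model

  answerSet⇒minimalModel : ∀ P {M} → IsAnswerSet P M → IsMinimalModel (map clause P) M
  answerSet⇒minimalModel P (model , minimal) =
    isPDModel⇒isModel P model , λ N N⊂M modelN → minimal N N⊂M (isModel⇒isPDModel P (proj₁ N⊂M) modelN)

  answerSets-bound : ∀ P → All (λ r → dsize r ≤ 2) P → AtMostCubeRoot3^ n (IsAnswerSet P)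
  answerSets-bound P short Ms unique answerSets =
    TwoCNF.minimalModels-bound (map clause P) short′ Ms unique (All.map (answerSet⇒minimalModel P) answerSets)
    where
    short′ = All.map⁺ (All.map (λ {r} → subst (_≤ 2) (sym (length-clause r))) short)

  toDisjunctive : NClause n → DClause n
  toDisjunctive r = (head r ∷ []) ⟵d posBody r ∣ negBody r

  toPositiveDisjunctive : HClause n → PDClause n
  toPositiveDisjunctive r = (hhead r ∷ []) ⟵pd hbody r

  dreduct-toDisjunctive : ∀ P M → dreduct (map toDisjunctive P) M ≡ map toPositiveDisjunctive (nreduct P M)
  dreduct-toDisjunctive []      M = refl
  dreduct-toDisjunctive (r ∷ P) M with allOut M (negBody r)
  ... | true  = cong (_ ∷_) (dreduct-toDisjunctive P M)
  ... | false = dreduct-toDisjunctive P M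

  stable⇒answerSet : ∀ P {M} → IsStableModel P M → IsAnswerSet (map toDisjunctive P) M
  stable⇒answerSet P {M} (model , least) rewrite dreduct-toDisjunctive P M =
    All.map⁺ (All.map (here ∘_) model) ,
    λ { N (_ , x , x∈M , x∉N) modelN →
          x∉N (least N (All.map (Any.singleton⁻ ∘_) (All.map⁻ modelN)) x∈M) }

  stableModels-bound : ∀ P → IsNormalTProgram 2 P → AtMostCubeRoot3^ n (IsStableModel P)
  stableModels-bound P short Ms unique stable =
    answerSets-bound (map toDisjunctive P) (All.map⁺ short) Ms unique (All.map (stable⇒answerSet P) stable)

theorem2p2 : (∀ (n : ℕ) (T : Theory n) → IsTCNF 2 T → (∀ (a : Fin n) → OccursT T a) →
    AtMostCubeRoot3^ n (IsMinimalModel T))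
    × (∀ (n : ℕ) (P : NProgram n) → IsNormalTProgram 2 P → (∀ (a : Fin n) → OccursN P a) →
    AtMostCubeRoot3^ n (IsStableModel P))
    × (∀ (n : ℕ) (P : DProgram n) → IsDisjunctiveTProgram 2 P → (∀ (a : Fin n) → OccursD P a) →
    AtMostCubeRoot3^ n (IsAnswerSet P))
theorem2p2 =
    (λ n T twoCNF _ → TwoCNF.minimalModels-bound T (All.map proj₁ twoCNF))
  , (λ n P twoProgram _ → Programs.stableModels-bound P twoProgram)
  , (λ n P twoProgram _ → Programs.answerSets-bound P (All.map proj₂ twoProgram))
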